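{- Let $n\ge 3$ and let $\phi$ be a vincular $3$-pattern with $k_\phi\le 3$. Let $\ell\ge 3$ and fix a total order of the symbols $i_1,i_2,i_3,y_4,\dots,y_\ell$ that is compatible with $CI_\phi$. Then the number $v_\ell(\phi)$ of tuples $(i_1,i_2,i_3,y_4,\dots,y_\ell)$ of elements of $[n]$ that satisfy $CI_\phi$ and whose values are ordered according to the fixed total order (strictly increasing along it) does not depend on which compatible total order was chosen, and $$v_\ell(\phi)=\binom{n-k_\phi}{\ell-k_\phi}.$$
   Context: A vincular 3-pattern $\phi$ is a permutation $\phi_1\phi_2\phi_3\in S_3$ enclosed on the left by "[" or "(" and on the right by "]" or ")", with optionally a dash between $\phi_1,\phi_2$ and between $\phi_2,\phi_3$. An occurrence of $\phi$ in $\pi\in S_n$ is a subsequence $\pi_{i_1}\pi_{i_2}\pi_{i_3}$ ($i_1<i_2<i_3$) in the same relative order as $\phi_1\phi_2\phi_3$ such that: $i_2=i_1+1$ if there is no dash between $\phi_1,\phi_2$; $i_3=i_2+1$ if there is no dash between $\phi_2,\phi_3$; $i_1=1$ if $\phi$ begins with "["; $i_3=n$ if $\phi$ ends with "]". $CI_\phi$ is the set of these conditions on $(i_1,i_2,i_3)$ together with $i_1<i_2<i_3$, and $k_\phi$ is the number of conditions imposed by square brackets and missing dashes (so $0\le k_\phi\le 4$). A total order on $\{i_1,i_2,i_3,y_4,\dots,y_\ell\}$ is compatible with $CI_\phi$ if $i_1<i_2<i_3$ in it, no symbol precedes $i_1$ when $\phi$ begins with "[", no symbol follows $i_3$ when $\phi$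 ends with "]", and no symbol lies strictly between two $i$'s whose adjacency is required by a missing dash. -}

module Defs where

open import Data.Bool using (Bool; true; false)
open import Data.Nat using (ℕ; zero; suc; _+_; _≤_; _<_)
import Data.Nat as ℕ
import Data.Nat.Properties as ℕP
open import Data.Fin using (Fin; zero; suc; toℕ)
import Data.Fin as F
import Data.Fin.Properties as FP
open import Data.Fin.Permutation using (Permutation; _⟨$⟩ʳ_)
open import Data.Vec using (Vec; []; _∷_; lookup)
open import Data.List using (List; []; _∷_; concatMap; map; filter; length)
open import Data.Product using (_×_; _,_)
open import Data.Unit using (⊤; tt)
open import Relation.Nullary using (¬_; Dec; yes; no)
open import Relation.Nullary.Decidable using (_×-dec_; _→-dec_; ¬?)
open import Relation.Binary.PropositionalEquality using (_≡_)

-- Vincular 3-patterns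
--   perm     : the permutation φ₁φ₂φ₃ ∈ S₃
--   leftSq   : true iff φ begins with "["  (false: "(")
--   dash12   : true iff there is a dash between φ₁ and φ₂
--   dash23   : true iff there is a dash between φ₂ and φ₃
--   rightSq  : true iff φ ends with "]"    (false: ")")

record VPattern : Set where
  constructor vpat
  field
    perm    : Permutation 3 3
    leftSq  : Bool
    dash12  : Bool
    dash23  : Bool
    rightSq : Bool

open VPattern public

present : Bool → ℕ        -- a square bracket imposes a condition
present true  = 1
present false = 0

absent : Bool → ℕ         -- a missing dash imposes a condition
absent true  = 0
absent false = 1

kφ : VPattern → ℕ
kφ φ = present (leftSq φ) + absent (dash12 φ) + absent (dash23 φ) + present (rightSq φ)

WhenTrue : Bool → Set → Set
WhenTrue true  P = P
WhenTrue false _ = ⊤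

WhenFalse : Bool → Set → Set
WhenFalse true  _ = ⊤
WhenFalse false P = P

whenTrue? : ∀ b {P : Set} → Dec P → Dec (WhenTrue b P)
whenTrue? true  d = d
whenTrue? false _ = yes tt

whenFalse? : ∀ b {P : Set} → Dec P → Dec (WhenFalse b P)
whenFalse? true  _ = yes tt
whenFalse? false d = d

-- Symbols i₁,i₂,i₃,y₄,…,y_ℓ with ℓ = 3 + m, encoded as Fin (3 + m):
-- 0 ↦ i₁, 1 ↦ i₂, 2 ↦ i₃, 3+j ↦ y_{4+j}.

Sym : ℕ → Set
Sym m = Fin (3 + m)

s₁ s₂ s₃ : ∀ {m} → Sym m
s₁ = zero
s₂ = suc zero
s₃ = suc (suc zero)

-- A total order on the symbols is given by a bijection σ assigning to each
-- symbol its rank (position) in the order: a comes before b iff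
-- rank σ a < rank σ b.
TotalOrder : ℕ → Set
TotalOrder m = Permutation (3 + m) (3 + m)

rank : ∀ {m} → TotalOrder m → Sym m → ℕ
rank σ s = toℕ (σ ⟨$⟩ʳ s)

Compatible : ∀ {m} → VPattern → TotalOrder m → Set
Compatible {m} φ σ =
  (rank σ s₁ < rank σ s₂) ×
  (rank σ s₂ < rank σ s₃) ×
  WhenTrue (leftSq φ)  ((s : Sym m) → rank σ s₁ ≤ rank σ s) ×
  WhenTrue (rightSq φ) ((s : Sym m) → rank σ s ≤ rank σ s₃) ×
  WhenFalse (dash12 φ) ((s : Sym m) → ¬ (rank σ s₁ < rank σ s × rank σ s < rank σ s₂)) ×
  WhenFalse (dash23 φ) ((s : Sym m) → ¬ (rank σ s₂ < rank σ s × rank σ s < rank σ s₃))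

-- Tuples (i₁,i₂,i₃,y₄,…,y_ℓ) of elements of [n]; the value k ∈ [n] is
-- represented by the element of Fin n with toℕ = k - 1.

val : ∀ {n m} → Vec (Fin n) (3 + m) → Sym m → ℕ
val t s = suc (toℕ (lookup t s))

SatCI : ∀ {n m} → VPattern → Vec (Fin n) (3 + m) → Set
SatCI {n} φ t =
  (val t s₁ < val t s₂) ×
  (val t s₂ < val t s₃) ×
  WhenTrue (leftSq φ)  (val t s₁ ≡ 1) ×
  WhenTrue (rightSq φ) (val t s₃ ≡ n) ×
  WhenFalse (dash12 φ) (val t s₂ ≡ suc (val t s₁)) ×
  WhenFalse (dash23 φ) (val t s₃ ≡ suc (val t s₂))

OrderedBy : ∀ {n m} → TotalOrder m → Vec (Fin n) (3 + m) → Set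
OrderedBy {m = m} σ t = (a b : Sym m) → rank σ a < rank σ b → val t a < val t b

Good : ∀ {n m} → VPattern → TotalOrder m → Vec (Fin n) (3 + m) → Set
Good φ σ t = SatCI φ t × OrderedBy σ t

good? : ∀ {n m} φ σ (t : Vec (Fin n) (3 + m)) → Dec (Good φ σ t)
good? {n} φ σ t =
  ((val t s₁ ℕ.<? val t s₂) ×-dec
   (val t s₂ ℕ.<? val t s₃) ×-dec
   whenTrue? (leftSq φ) (val t s₁ ℕP.≟ 1) ×-dec
   whenTrue? (rightSq φ) (val t s₃ ℕP.≟ n) ×-dec
   whenFalse? (dash12 φ) (val t s₂ ℕP.≟ suc (val t s₁)) ×-dec
   whenFalse? (dash23 φ) (val t s₃ ℕP.≟ suc (val t s₂)))
  ×-dec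
  FP.all? (λ a → FP.all? (λ b →
    (rank σ a ℕ.<? rank σ b) →-dec (val t a ℕ.<? val t b)))

allTuples : ∀ n k → List (Vec (Fin n) k)
allTuples n zero    = [] ∷ []
allTuples n (suc k) =
  concatMap (λ x → map (x ∷_) (allTuples n k)) (Data.Vec.toList (Data.Vec.allFin n))

v : ∀ n {m} → VPattern → TotalOrder m → ℕ
v n {m} φ σ = length (filter (good? φ σ) (allTuples n (3 + m)))

{-# OPTIONS --with-K #-}

-- Sorting a tuple along the total order σ turns the tuples counted by v into the strictly
-- increasing sequences w₀ < w₁ < ⋯ < w_{ℓ-1} in [0, n - 1]. Such a sequence has ℓ + 1 gaps: below
-- w₀, between consecutive entries, and above w_{ℓ-1}. As σ is compatible with CI_φ, each of the k_φ
-- conditions imposed by a bracket or a missing dash says exactly that one particular gap is empty,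
-- and distinct conditions concern distinct gaps. Increasing sequences with k prescribed empty gaps
-- correspond to weak compositions of n - ℓ into ℓ + 1 - k parts (the sizes of the other gaps), and
-- there are C(n - k, ℓ - k) of those.

module Submission where

open import Defs
open import Data.Bool using (Bool; true; false; not)
open import Data.Fin as Fin using (Fin; zero; suc; toℕ; fromℕ; fromℕ<)
import Data.Fin.Properties as Finₚ
open import Data.Fin.Permutation using (Permutation; _⟨$⟩ʳ_; _⟨$⟩ˡ_; flip; inverseˡ; inverseʳ)
open import Data.Fin.Subset
  using (Subset; inside; outside; ⁅_⁆; _∪_; _∩_; ∁; ∣_∣; Empty)
  renaming (⊥ to ∅; _∈_ to _∈ₛ_; _∉_ to _∉ₛ_)
open import Data.Fin.Subset.Properties
  using (_∈?_; ∉⊥; x∈⁅x⁆; x∈⁅y⁆⇒x≡y; x∈p∪q⁻; x∈p∪q⁺; x∈p∩q⁻; ∣⁅x⁆∣≡1; ∣⊥∣≡0; ∣∁p∣≡n∸∣p∣)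
open import Data.List using (List; []; _∷_; _++_; map; filter; length; concatMap; cartesianProductWith)
import Data.List as List
open import Data.List.Properties
  using (length-map; length-++; filter-++; filter-accept; filter-reject; filter-none)
open import Data.List.Membership.Propositional using (_∈_)
open import Data.List.Membership.Propositional.Properties
  using (∈-map⁺; ∈-map⁻; ∈-filter⁺; ∈-filter⁻; ∈-++⁺ˡ; ∈-++⁺ʳ; ∈-++⁻; ∈-allFin;
         ∈-cartesianProductWith⁺)
open import Data.List.Membership.Propositional.Properties.WithK using (unique∧set⇒bag)
open import Data.List.Relation.Unary.Any using (here; there)
open import Data.List.Relation.Unary.All using (All; universal; [])
open import Data.List.Relation.Unary.All.Properties using (map⁺)
open import Data.List.Relation.Unary.Unique.Propositional using (Unique; []; _∷_)
import Data.List.Relation.Unary.Unique.Propositional.Properties as Unique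
open import Data.List.Relation.Binary.BagAndSetEquality using (_∼[_]_; bag; ∼bag⇒↭)
open import Data.List.Relation.Binary.Permutation.Propositional.Properties using (↭-length)
open import Data.Nat using (ℕ; zero; suc; _+_; _∸_; _≤_; _<_; z≤n; s≤s; z<s; _≤?_)
open import Data.Nat.Properties
  using (≤-pred; ≤-trans; <-trans; ≤-<-trans; ≤-reflexive; m<n⇒m<1+n; m≤n⇒m<n∨m≡n; ≰⇒>;
         n≤0⇒n≡0; +-suc; +-identityʳ; +-assoc; +-comm; +-∸-assoc; m+[n∸m]≡n; m∸n+n≡m; m≤m+n; ∸-monoˡ-<)
import Data.Nat.Properties as ℕ
open import Data.Nat.Combinatorics using (_C_; nCn≡1; k>n⇒nCk≡0; nCk+nC[k+1]≡[n+1]C[k+1])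
open import Data.Product using (_×_; _,_; ∃-syntax)
open import Data.Product.Function.NonDependent.Propositional using (_×-⇔_)
open import Data.Sum using (inj₁; inj₂; [_,_])
open import Data.Unit using (tt)
open import Data.Vec as Vec using (Vec; []; _∷_; lookup; tabulate; here; there)
open import Data.Vec.Properties
  using (lookup∘tabulate; tabulate∘lookup; tabulate-cong; lookup-map; ∷-injective; ∷-injectiveʳ)
open import Function using (_∘_; id; _⇔_; mk⇔; Equivalence; Injective)
open import Function.Construct.Composition using (_⇔-∘_)
open import Function.Construct.Identity using (⇔-id)
open import Function.Construct.Symmetry using (⇔-sym)
open import Level using (0ℓ)
open import Relation.Nullary using (¬_; Dec; yes; no; contradiction)
open import Relation.Nullary.Decidable using (_→-dec_)
open import Relation.Unary using (Pred; Decidable)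
open import Relation.Binary.PropositionalEquality
  using (_≡_; _≢_; ≢-sym; refl; sym; trans; cong; cong₂; subst; subst₂; module ≡-Reasoning)

open Equivalence using (to; from)

length-filter-bijection :
  ∀ {A B : Set} {P : Pred A 0ℓ} {Q : Pred B 0ℓ} (P? : Decidable P) (Q? : Decidable Q)
    {xs : List A} {ys : List B} → Unique xs → Unique ys →
  (f : A → B) → Injective _≡_ _≡_ f →
  (∀ {x} → x ∈ xs → P x → f x ∈ ys × Q (f x)) →
  (∀ {y} → y ∈ ys → Q y → ∃[ x ] x ∈ xs × P x × f x ≡ y) →
  length (filter P? xs) ≡ length (filter Q? ys)
length-filter-bijection P? Q? {xs} {ys} xs! ys! f f-inj f-into f-onto = begin
  length (filter P? xs)          ≡⟨ length-map f (filter P? xs) ⟨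
  length (map f (filter P? xs))  ≡⟨ ↭-length (∼bag⇒↭ image≈bag) ⟩
  length (filter Q? ys)          ∎
  where
  open ≡-Reasoning
  image⊆ : ∀ {y} → y ∈ map f (filter P? xs) → y ∈ filter Q? ys
  image⊆ y∈ with x , x∈ , refl ← ∈-map⁻ f y∈ with x∈xs , Px ← ∈-filter⁻ P? x∈
    with fx∈ys , Qfx ← f-into x∈xs Px = ∈-filter⁺ Q? fx∈ys Qfx
  image⊇ : ∀ {y} → y ∈ filter Q? ys → y ∈ map f (filter P? xs)
  image⊇ y∈ with y∈ys , Qy ← ∈-filter⁻ Q? y∈ with x , x∈xs , Px , refl ← f-onto y∈ys Qy =
    ∈-map⁺ f (∈-filter⁺ P? x∈xs Px)
  image≈bag : map f (filter P? xs) ∼[ bag ] filter Q? ys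
  image≈bag = unique∧set⇒bag (Unique.map⁺ f-inj (Unique.filter⁺ P? xs!)) (Unique.filter⁺ Q? ys!)
                             (mk⇔ image⊆ image⊇)

length-filter-map :
  ∀ {A B : Set} {P : Pred B 0ℓ} {Q : Pred A 0ℓ} (P? : Decidable P) (Q? : Decidable Q) (f : A → B) →
  (∀ x → P (f x) ⇔ Q x) → ∀ xs → length (filter P? (map f xs)) ≡ length (filter Q? xs)
length-filter-map P? Q? f P∘f⇔Q []       = refl
length-filter-map P? Q? f P∘f⇔Q (x ∷ xs) with P? (f x) | Q? x
... | yes _   | yes _  = cong suc (length-filter-map P? Q? f P∘f⇔Q xs)
... | no _    | no _   = length-filter-map P? Q? f P∘f⇔Q xs
... | yes Pfx | no ¬Qx = contradiction (to (P∘f⇔Q x) Pfx) ¬Qx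
... | no ¬Pfx | yes Qx = contradiction (from (P∘f⇔Q x) Qx) ¬Pfx

allTuples-suc : ∀ n k → allTuples n (suc k) ≡ cartesianProductWith _∷_ (List.allFin n) (allTuples n k)
allTuples-suc n k =
  trans (cong (concatMap prepend) (toList∘tabulate id)) (concatMap≡cartesian (List.allFin n))
  where
  prepend : Fin n → List (Vec (Fin n) (suc k))
  prepend x = map (x ∷_) (allTuples n k)
  toList∘tabulate : ∀ {A : Set} {l} (f : Fin l → A) → Vec.toList (tabulate f) ≡ List.tabulate f
  toList∘tabulate {l = zero}  f = refl
  toList∘tabulate {l = suc l} f = cong (f zero ∷_) (toList∘tabulate (f ∘ suc))
  concatMap≡cartesian : ∀ xs → concatMap prepend xs ≡ cartesianProductWith _∷_ xs (allTuples n k)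
  concatMap≡cartesian []       = refl
  concatMap≡cartesian (x ∷ xs) = cong (prepend x ++_) (concatMap≡cartesian xs)

allTuples-unique : ∀ n k → Unique (allTuples n k)
allTuples-unique n zero    = [] ∷ []
allTuples-unique n (suc k) rewrite allTuples-suc n k =
  Unique.cartesianProductWith⁺ _∷_ ∷-injective (Unique.allFin⁺ n) (allTuples-unique n k)

∈-allTuples : ∀ {n k} (t : Vec (Fin n) k) → t ∈ allTuples n k
∈-allTuples         []      = here refl
∈-allTuples {n} {suc k} (x ∷ t) rewrite allTuples-suc n k =
  ∈-cartesianProductWith⁺ _∷_ (∈-allFin x) (∈-allTuples t)

Increasing : ∀ {n L} → Vec (Fin n) L → Set
Increasing w = ∀ {i j} → i Fin.< j → lookup w i Fin.< lookup w j

allIncreasing : ∀ n L → List (Vec (Fin n) L)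
allIncreasing n       zero    = [] ∷ []
allIncreasing zero    (suc L) = []
allIncreasing (suc n) (suc L) =
  map ((zero ∷_) ∘ Vec.map suc) (allIncreasing n L) ++ map (Vec.map suc) (allIncreasing n (suc L))

allIncreasing-[] : ∀ {n L} → n < L → allIncreasing n L ≡ []
allIncreasing-[] {zero}  {suc L} _ = refl
allIncreasing-[] {suc n} {suc L} (s≤s n<L)
  rewrite allIncreasing-[] n<L | allIncreasing-[] (m<n⇒m<1+n n<L) = refl

Increasing-tail : ∀ {n L} {x : Fin n} {w : Vec (Fin n) L} → Increasing (x ∷ w) → Increasing w
Increasing-tail inc i<j = inc (s≤s i<j)

Increasing-map-suc⁺ : ∀ {n L} {u : Vec (Fin n) L} → Increasing u → Increasing (Vec.map suc u)
Increasing-map-suc⁺ {u = u} inc {i} {j} i<j =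
  subst₂ Fin._<_ (sym (lookup-map i suc u)) (sym (lookup-map j suc u)) (s≤s (inc i<j))

Increasing-map-suc⁻ : ∀ {n L} {u : Vec (Fin n) L} → Increasing (Vec.map suc u) → Increasing u
Increasing-map-suc⁻ {u = u} inc {i} {j} i<j =
  ≤-pred (subst₂ Fin._<_ (lookup-map i suc u) (lookup-map j suc u) (inc i<j))

Increasing-zero∷ : ∀ {n L} {u : Vec (Fin n) L} → Increasing u → Increasing (zero ∷ Vec.map suc u)
Increasing-zero∷         inc {zero}  {zero}  ()
Increasing-zero∷ {u = u} inc {zero}  {suc j} _ = subst (λ x → 0 < toℕ x) (sym (lookup-map j suc u)) z<s
Increasing-zero∷         inc {suc i} {zero}  ()
Increasing-zero∷ {u = u} inc {suc i} {suc j} (s≤s i<j) = Increasing-map-suc⁺ {u = u} inc i<j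

map-suc⁻ : ∀ {n L} (w : Vec (Fin (suc n)) L) → (∀ i → 0 < toℕ (lookup w i)) →
  ∃[ u ] w ≡ Vec.map suc u
map-suc⁻ []          _   = [] , refl
map-suc⁻ (zero  ∷ w) pos with () ← pos zero
map-suc⁻ (suc x ∷ w) pos with u , refl ← map-suc⁻ w (pos ∘ suc) = x ∷ u , refl

∈-allIncreasing⁺ : ∀ {n L} {w : Vec (Fin n) L} → Increasing w → w ∈ allIncreasing n L
∈-allIncreasing⁺ {L = zero}  {[]}    _ = here refl
∈-allIncreasing⁺ {zero}  {suc L} {() ∷ _} _
∈-allIncreasing⁺ {suc n} {suc L} {x ∷ w} inc
  with u , refl ← map-suc⁻ w (λ i → ≤-<-trans z≤n (inc {zero} {suc i} z<s)) | x
... | zero  = ∈-++⁺ˡ (∈-map⁺ _ (∈-allIncreasing⁺ (Increasing-map-suc⁻ {u = u} (Increasing-tail inc))))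
... | suc y = ∈-++⁺ʳ _ (∈-map⁺ _ (∈-allIncreasing⁺ (Increasing-map-suc⁻ {u = y ∷ u} inc)))

∈-allIncreasing⁻ : ∀ {n L} {w : Vec (Fin n) L} → w ∈ allIncreasing n L → Increasing w
∈-allIncreasing⁻ {L = zero}  {[]} _ {()}
∈-allIncreasing⁻ {suc n} {suc L} w∈ with ∈-++⁻ (map ((zero ∷_) ∘ Vec.map suc) (allIncreasing n L)) w∈
... | inj₁ w∈₁ with u , u∈ , refl ← ∈-map⁻ _ w∈₁ = Increasing-zero∷ {u = u} (∈-allIncreasing⁻ u∈)
... | inj₂ w∈₂ with u , u∈ , refl ← ∈-map⁻ _ w∈₂ = Increasing-map-suc⁺ {u = u} (∈-allIncreasing⁻ u∈)

allIncreasing-unique : ∀ n L → Unique (allIncreasing n L)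
allIncreasing-unique n       zero    = [] ∷ []
allIncreasing-unique zero    (suc L) = []
allIncreasing-unique (suc n) (suc L) =
  Unique.++⁺ (Unique.map⁺ (map-suc-injective ∘ ∷-injectiveʳ) (allIncreasing-unique n L))
             (Unique.map⁺ map-suc-injective (allIncreasing-unique n (suc L)))
             zero≢suc
  where
  map-suc-injective : ∀ {l} → Injective _≡_ _≡_ (Vec.map {n = l} (suc {n}))
  map-suc-injective {x = []}    {[]}    _  = refl
  map-suc-injective {x = _ ∷ _} {_ ∷ _} eq with x≡y , xs≡ys ← ∷-injective eq =
    cong₂ _∷_ (Finₚ.suc-injective x≡y) (map-suc-injective xs≡ys)
  zero≢suc : ∀ {w : Vec (Fin (suc n)) (suc L)} → ¬ (w ∈ map ((zero ∷_) ∘ Vec.map suc) (allIncreasing n L)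
                        × w ∈ map (Vec.map suc) (allIncreasing n (suc L)))
  zero≢suc (w∈₁ , w∈₂) with ∈-map⁻ _ w∈₁ | ∈-map⁻ _ w∈₂
  ... | _ , _ , refl | _ ∷ _ , _ , ()

-- Gap j of w inside [lo, hi) consists of the values strictly between w[j - 1] and w[j], reading
-- w[-1] as lo - 1 and w[L] as hi; so gap suc i is the one just above w[i].
EmptyGap : ∀ {n L} → ℕ → ℕ → Vec (Fin n) L → Fin (suc L) → Set
EmptyGap lo hi []      zero    = lo ≡ hi
EmptyGap lo hi (x ∷ w) zero    = toℕ x ≡ lo
EmptyGap lo hi (x ∷ w) (suc j) = EmptyGap (suc (toℕ x)) hi w j

emptyGap? : ∀ {n L} lo hi (w : Vec (Fin n) L) j → Dec (EmptyGap lo hi w j)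
emptyGap? lo hi []      zero    = lo ℕ.≟ hi
emptyGap? lo hi (x ∷ w) zero    = toℕ x ℕ.≟ lo
emptyGap? lo hi (x ∷ w) (suc j) = emptyGap? (suc (toℕ x)) hi w j

Tight : ∀ {n L} → Subset (suc L) → Vec (Fin n) L → Set
Tight {n} Z w = ∀ j → j ∈ₛ Z → EmptyGap 0 n w j

tight? : ∀ {n L} (Z : Subset (suc L)) → Decidable (Tight {n} Z)
tight? Z w = Finₚ.all? λ j → j ∈? Z →-dec emptyGap? 0 _ w j

countTight : ∀ n L → Subset (suc L) → ℕ
countTight n L Z = length (filter (tight? Z) (allIncreasing n L))

suc-≡-⇔ : ∀ {a b} → (suc a ≡ suc b) ⇔ (a ≡ b)
suc-≡-⇔ = mk⇔ ℕ.suc-injective (cong suc)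

EmptyGap-map-suc : ∀ {n L} lo hi (w : Vec (Fin n) L) j →
  EmptyGap (suc lo) (suc hi) (Vec.map suc w) j ⇔ EmptyGap lo hi w j
EmptyGap-map-suc lo hi []      zero    = suc-≡-⇔
EmptyGap-map-suc lo hi (x ∷ w) zero    = suc-≡-⇔
EmptyGap-map-suc lo hi (x ∷ w) (suc j) = EmptyGap-map-suc (suc (toℕ x)) hi w j

EmptyGap-last : ∀ {n L} lo hi (w : Vec (Fin n) (suc L)) →
  EmptyGap lo hi w (suc (fromℕ L)) ⇔ (suc (toℕ (lookup w (fromℕ L))) ≡ hi)
EmptyGap-last {L = zero}  lo hi (x ∷ []) = ⇔-id _
EmptyGap-last {L = suc L} lo hi (x ∷ w)  = EmptyGap-last (suc (toℕ x)) hi w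

EmptyGap-adjacent : ∀ {n L} lo hi (w : Vec (Fin n) L) (i j : Fin L) → toℕ j ≡ suc (toℕ i) →
  EmptyGap lo hi w (suc i) ⇔ (toℕ (lookup w j) ≡ suc (toℕ (lookup w i)))
EmptyGap-adjacent lo hi (x ∷ y ∷ w) zero    (suc zero) refl = ⇔-id _
EmptyGap-adjacent lo hi (x ∷ w)     (suc i) (suc j)    j≡1+i =
  EmptyGap-adjacent (suc (toℕ x)) hi w i j (ℕ.suc-injective j≡1+i)
EmptyGap-adjacent _  _  _           zero    zero           ()
EmptyGap-adjacent _  _  _           zero    (suc (suc _))  ()
EmptyGap-adjacent _  _  _           (suc _) zero           ()

Tight-zero∷ : ∀ {n L} b (Z : Subset (suc L)) (u : Vec (Fin n) L) →
  Tight (b ∷ Z) (zero ∷ Vec.map suc u) ⇔ Tight Z u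
Tight-zero∷ b Z u = mk⇔
  (λ tight j j∈Z → to (EmptyGap-map-suc 0 _ u j) (tight (suc j) (there j∈Z)))
  (λ { tight zero    _           → refl
     ; tight (suc j) (there j∈Z) → from (EmptyGap-map-suc 0 _ u j) (tight j j∈Z) })

Tight-map-suc : ∀ {n L} (Z : Subset (suc L)) (u : Vec (Fin n) (suc L)) →
  Tight (outside ∷ Z) (Vec.map suc u) ⇔ Tight (outside ∷ Z) u
Tight-map-suc Z (x ∷ u) = mk⇔
  (λ { tight (suc j) j∈Z → to   (EmptyGap-map-suc (suc (toℕ x)) _ u j) (tight (suc j) j∈Z) })
  (λ { tight (suc j) j∈Z → from (EmptyGap-map-suc (suc (toℕ x)) _ u j) (tight (suc j) j∈Z) })

¬Tight-map-suc : ∀ {n L} (Z : Subset (suc L)) (u : Vec (Fin n) (suc L)) →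
  ¬ Tight (inside ∷ Z) (Vec.map suc u)
¬Tight-map-suc Z (x ∷ u) tight with () ← tight zero here

-- An increasing sequence in [0, n] either starts at 0, so that gap 0 is empty, or is the shift of
-- an increasing sequence in [0, n - 1], so that gap 0 is not: the Pascal recursion of allIncreasing.
module _ (n L : ℕ) (Z : Subset (suc L)) where

  private
    starting-at-zero avoiding-zero : List (Vec (Fin (suc n)) (suc L))
    starting-at-zero = map ((zero ∷_) ∘ Vec.map suc) (allIncreasing n L)
    avoiding-zero    = map (Vec.map suc) (allIncreasing n (suc L))

    #tight : Subset (2 + L) → List (Vec (Fin (suc n)) (suc L)) → ℕ
    #tight Z′ ws = length (filter (tight? Z′) ws)

    split : ∀ b → countTight (suc n) (suc L) (b ∷ Z) ≡
                  #tight (b ∷ Z) starting-at-zero + #tight (b ∷ Z) avoiding-zero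
    split b = trans (cong length (filter-++ (tight? (b ∷ Z)) starting-at-zero avoiding-zero))
                    (length-++ (filter (tight? (b ∷ Z)) starting-at-zero))

    #tight-starting-at-zero : ∀ b → #tight (b ∷ Z) starting-at-zero ≡ countTight n L Z
    #tight-starting-at-zero b =
      length-filter-map (tight? (b ∷ Z)) (tight? Z) _ (Tight-zero∷ b Z) (allIncreasing n L)

  countTight-inside : countTight (suc n) (suc L) (inside ∷ Z) ≡ countTight n L Z
  countTight-inside = begin
    countTight (suc n) (suc L) (inside ∷ Z)
      ≡⟨ split inside ⟩
    #tight (inside ∷ Z) starting-at-zero + #tight (inside ∷ Z) avoiding-zero
      ≡⟨ cong₂ _+_ (#tight-starting-at-zero inside)
                   (cong length (filter-none (tight? (inside ∷ Z)) none-tight)) ⟩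
    countTight n L Z + 0
      ≡⟨ +-identityʳ _ ⟩
    countTight n L Z
      ∎
    where
    open ≡-Reasoning
    none-tight : All (¬_ ∘ Tight (inside ∷ Z)) avoiding-zero
    none-tight = map⁺ (universal (¬Tight-map-suc Z) (allIncreasing n (suc L)))

  countTight-outside :
    countTight (suc n) (suc L) (outside ∷ Z) ≡ countTight n L Z + countTight n (suc L) (outside ∷ Z)
  countTight-outside = trans (split outside)
    (cong₂ _+_ (#tight-starting-at-zero outside)
               (length-filter-map (tight? (outside ∷ Z)) (tight? (outside ∷ Z)) _ (Tight-map-suc Z)
                                  (allIncreasing n (suc L))))

countTight-[] : ∀ {n L} (Z : Subset (suc L)) → n < L → countTight n L Z ≡ 0
countTight-[] Z n<L = cong (length ∘ filter (tight? Z)) (allIncreasing-[] n<L)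

-- Split on whether the first part is 0.
weakCompositions : ℕ → ℕ → ℕ
weakCompositions zero    _       = 1
weakCompositions (suc N) zero    = 0
weakCompositions (suc N) (suc P) = weakCompositions (suc N) P + weakCompositions N (suc P)

weakCompositions-suc : ∀ N P → weakCompositions N (suc P) ≡ (N + P) C P
weakCompositions-suc zero    P       = sym (nCn≡1 P)
weakCompositions-suc (suc N) zero    = weakCompositions-suc N zero  -- by computation, as m C 0 = 1
weakCompositions-suc (suc N) (suc P) = begin
  weakCompositions (suc N) (suc P) + weakCompositions N (suc (suc P))
    ≡⟨ cong₂ _+_ (weakCompositions-suc (suc N) P) (weakCompositions-suc N (suc P)) ⟩
  suc (N + P) C P + (N + suc P) C suc P
    ≡⟨ cong (λ x → suc (N + P) C P + x C suc P) (+-suc N P) ⟩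
  suc (N + P) C P + suc (N + P) C suc P
    ≡⟨ nCk+nC[k+1]≡[n+1]C[k+1] (suc (N + P)) P ⟩
  suc (suc (N + P)) C suc P
    ≡⟨ cong (λ x → suc x C suc P) (+-suc N P) ⟨
  (suc N + suc P) C suc P
    ∎
  where open ≡-Reasoning

countTight-weakCompositions : ∀ N L (Z : Subset (suc L)) →
  countTight (L + N) L Z ≡ weakCompositions N ∣ ∁ Z ∣
countTight-weakCompositions N       zero    (outside ∷ []) =
  trans (cong length (filter-accept (tight? {N} (outside ∷ [])) {[]} {[]} λ { zero () }))
        (sym (weakCompositions-suc N 0))
countTight-weakCompositions zero    zero    (inside ∷ [])  =
  cong length (filter-accept (tight? {0} (inside ∷ [])) {[]} {[]} λ { zero here → refl })
countTight-weakCompositions (suc N) zero    (inside ∷ [])  =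
  cong length (filter-reject (tight? {suc N} (inside ∷ [])) {[]} {[]}
                             λ tight → contradiction (tight zero here) λ ())
countTight-weakCompositions N       (suc L) (inside ∷ Z)   =
  trans (countTight-inside (L + N) L Z) (countTight-weakCompositions N L Z)
countTight-weakCompositions zero    (suc L) (outside ∷ Z)  =
  trans (countTight-outside (L + 0) L Z)
        (cong₂ _+_ (countTight-weakCompositions 0 L Z)
                   (countTight-[] (outside ∷ Z) (s≤s (≤-reflexive (+-identityʳ L)))))
countTight-weakCompositions (suc N) (suc L) (outside ∷ Z)  =
  trans (countTight-outside (L + suc N) L Z)
        (cong₂ _+_ (countTight-weakCompositions (suc N) L Z)
                   (trans (cong (λ n → countTight n (suc L) (outside ∷ Z)) (+-suc L N))
                          (countTight-weakCompositions N (suc L) (outside ∷ Z))))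

countTight-binomial : ∀ {n L} (Z : Subset (suc L)) → ∣ Z ∣ ≤ L → ∣ Z ∣ ≤ n →
  countTight n L Z ≡ (n ∸ ∣ Z ∣) C (L ∸ ∣ Z ∣)
countTight-binomial {n} {L} Z k≤L k≤n with L ≤? n
... | no L≰n = trans (countTight-[] Z (≰⇒> L≰n)) (sym (k>n⇒nCk≡0 (∸-monoˡ-< (≰⇒> L≰n) k≤n)))
... | yes L≤n = begin
  countTight n L Z                       ≡⟨ cong (λ n → countTight n L Z) (m+[n∸m]≡n L≤n) ⟨
  countTight (L + (n ∸ L)) L Z           ≡⟨ countTight-weakCompositions (n ∸ L) L Z ⟩
  weakCompositions (n ∸ L) ∣ ∁ Z ∣       ≡⟨ cong (weakCompositions (n ∸ L)) free ⟩
  weakCompositions (n ∸ L) (suc (L ∸ k)) ≡⟨ weakCompositions-suc (n ∸ L) (L ∸ k) ⟩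
  ((n ∸ L) + (L ∸ k)) C (L ∸ k)          ≡⟨ cong (_C (L ∸ k)) telescope ⟩
  (n ∸ k) C (L ∸ k)                      ∎
  where
  open ≡-Reasoning
  k : ℕ
  k = ∣ Z ∣
  free : ∣ ∁ Z ∣ ≡ suc (L ∸ k)
  free = trans (∣∁p∣≡n∸∣p∣ Z) (+-∸-assoc 1 k≤L)
  telescope : (n ∸ L) + (L ∸ k) ≡ n ∸ k
  telescope = trans (sym (+-∸-assoc (n ∸ L) k≤L)) (cong (_∸ k) (m∸n+n≡m L≤n))

when : ∀ {k} → Bool → Subset k → Subset k
when true  p = p
when false _ = ∅

∈-when⁻ : ∀ {k} b {p : Subset k} {i} → i ∈ₛ when b p → i ∈ₛ p
∈-when⁻ true  i∈ = i∈
∈-when⁻ false i∈ = contradiction i∈ ∉⊥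

∣when⁅⁆∣ : ∀ {k} b (i : Fin k) → ∣ when b ⁅ i ⁆ ∣ ≡ present b
∣when⁅⁆∣ true  i = ∣⁅x⁆∣≡1 i
∣when⁅⁆∣ {k} false _ = ∣⊥∣≡0 k

∣p∪q∣≡∣p∣+∣q∣ : ∀ {k} (p q : Subset k) → Empty (p ∩ q) → ∣ p ∪ q ∣ ≡ ∣ p ∣ + ∣ q ∣
∣p∪q∣≡∣p∣+∣q∣ []            []            _     = refl
∣p∪q∣≡∣p∣+∣q∣ (inside  ∷ p) (inside  ∷ q) empty = contradiction (zero , here) empty
∣p∪q∣≡∣p∣+∣q∣ (inside  ∷ p) (outside ∷ q) empty =
  cong suc (∣p∪q∣≡∣p∣+∣q∣ p q λ (i , i∈) → empty (suc i , there i∈))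
∣p∪q∣≡∣p∣+∣q∣ (outside ∷ p) (inside  ∷ q) empty =
  trans (cong suc (∣p∪q∣≡∣p∣+∣q∣ p q λ (i , i∈) → empty (suc i , there i∈)))
        (sym (+-suc ∣ p ∣ ∣ q ∣))
∣p∪q∣≡∣p∣+∣q∣ (outside ∷ p) (outside ∷ q) empty =
  ∣p∪q∣≡∣p∣+∣q∣ p q λ (i , i∈) → empty (suc i , there i∈)

∉-∪ : ∀ {k} (p q : Subset k) {i} → i ∉ₛ p → i ∉ₛ q → i ∉ₛ p ∪ q
∉-∪ p q i∉p i∉q = [ i∉p , i∉q ] ∘ x∈p∪q⁻ p q

∉-when⁅⁆ : ∀ {k} b {i : Fin k} j → i ≢ j → i ∉ₛ when b ⁅ j ⁆
∉-when⁅⁆ b j i≢j = i≢j ∘ x∈⁅y⁆⇒x≡y j ∘ ∈-when⁻ b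

∣when⁅⁆∪q∣ : ∀ {k} b (i : Fin k) q → i ∉ₛ q → ∣ when b ⁅ i ⁆ ∪ q ∣ ≡ present b + ∣ q ∣
∣when⁅⁆∪q∣ b i q i∉q =
  trans (∣p∪q∣≡∣p∣+∣q∣ (when b ⁅ i ⁆) q disjoint) (cong (_+ ∣ q ∣) (∣when⁅⁆∣ b i))
  where
  disjoint : Empty (when b ⁅ i ⁆ ∩ q)
  disjoint (j , j∈) with j∈i , j∈q ← x∈p∩q⁻ (when b ⁅ i ⁆) q j∈ =
    i∉q (subst (_∈ₛ q) (x∈⁅y⁆⇒x≡y i (∈-when⁻ b j∈i)) j∈q)

module _ {n L} (w : Vec (Fin n) L) where

  Tight-∪ : ∀ (p q : Subset (suc L)) → Tight (p ∪ q) w ⇔ (Tight p w × Tight q w)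
  Tight-∪ p q = mk⇔
    (λ tight → (λ j → tight j ∘ x∈p∪q⁺ ∘ inj₁) , (λ j → tight j ∘ x∈p∪q⁺ ∘ inj₂))
    (λ (tight-p , tight-q) j → [ tight-p j , tight-q j ] ∘ x∈p∪q⁻ p q)

  Tight-when⁅⁆ : ∀ b i → Tight (when b ⁅ i ⁆) w ⇔ WhenTrue b (EmptyGap 0 n w i)
  Tight-when⁅⁆ true  i = mk⇔ (λ tight → tight i (x∈⁅x⁆ i))
                             (λ gap j j∈ → subst (EmptyGap 0 n w) (sym (x∈⁅y⁆⇒x≡y i j∈)) gap)
  Tight-when⁅⁆ false _ = mk⇔ (λ _ → tt) (λ _ _ j∈ → contradiction j∈ ∉⊥)

permute : ∀ {A : Set} {k} → Permutation k k → Vec A k → Vec A k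
permute π t = tabulate (λ i → lookup t (π ⟨$⟩ˡ i))

lookup-permute : ∀ {A : Set} {k} (π : Permutation k k) (t : Vec A k) s →
  lookup (permute π t) (π ⟨$⟩ʳ s) ≡ lookup t s
lookup-permute π t s = trans (lookup∘tabulate _ (π ⟨$⟩ʳ s)) (cong (lookup t) (inverseˡ π))

permute-injective : ∀ {A : Set} {k} (π : Permutation k k) → Injective _≡_ _≡_ (permute {A} π)
permute-injective π {t} {t′} eq = begin
  t                    ≡⟨ tabulate∘lookup t ⟨
  tabulate (lookup t)  ≡⟨ tabulate-cong same ⟩
  tabulate (lookup t′) ≡⟨ tabulate∘lookup t′ ⟩
  t′                   ∎
  where
  open ≡-Reasoning
  same : ∀ s → lookup t s ≡ lookup t′ s
  same s = trans (sym (lookup-permute π t s))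
                 (trans (cong (λ u → lookup u (π ⟨$⟩ʳ s)) eq) (lookup-permute π t′ s))

permute-flip-inverse : ∀ {A : Set} {k} (π : Permutation k k) (w : Vec A k) →
  permute π (permute (flip π) w) ≡ w
permute-flip-inverse π w = trans (tabulate-cong (lookup-permute (flip π) w)) (tabulate∘lookup w)

module _ {m} (σ : TotalOrder m) where

  rank-⟨$⟩ˡ : ∀ i → rank σ (σ ⟨$⟩ˡ i) ≡ toℕ i
  rank-⟨$⟩ˡ i = cong toℕ (inverseʳ σ)

  least-rank : ∀ {a} → (∀ s → rank σ a ≤ rank σ s) → σ ⟨$⟩ʳ a ≡ zero
  least-rank a≤ =
    Finₚ.toℕ-injective (n≤0⇒n≡0 (subst (rank σ _ ≤_) (rank-⟨$⟩ˡ zero) (a≤ (σ ⟨$⟩ˡ zero))))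

  greatest-rank : ∀ {a} → (∀ s → rank σ s ≤ rank σ a) → σ ⟨$⟩ʳ a ≡ fromℕ (2 + m)
  greatest-rank ≤a =
    Finₚ.≤-antisym (Finₚ.≤fromℕ _)
                   (subst (_≤ rank σ _) (rank-⟨$⟩ˡ (fromℕ (2 + m))) (≤a (σ ⟨$⟩ˡ fromℕ (2 + m))))

  adjacent-ranks : ∀ {a b} → rank σ a < rank σ b → (∀ s → ¬ (rank σ a < rank σ s × rank σ s < rank σ b)) →
    rank σ b ≡ suc (rank σ a)
  adjacent-ranks {a} {b} a<b nothing-between with m≤n⇒m<n∨m≡n a<b
  ... | inj₂ 1+a≡b = sym 1+a≡b
  ... | inj₁ 1+a<b = contradiction
    (subst (rank σ a <_) (sym middle-rank) ℕ.≤-refl , subst (_< rank σ b) (sym middle-rank) 1+a<b)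
    (nothing-between (σ ⟨$⟩ˡ middle))
    where
    1+a<3+m : suc (rank σ a) < 3 + m
    1+a<3+m = <-trans 1+a<b (Finₚ.toℕ<n (σ ⟨$⟩ʳ b))
    middle : Fin (3 + m)
    middle = fromℕ< 1+a<3+m
    middle-rank : rank σ (σ ⟨$⟩ˡ middle) ≡ suc (rank σ a)
    middle-rank = trans (rank-⟨$⟩ˡ middle) (Finₚ.toℕ-fromℕ< 1+a<3+m)

  ordered⇔increasing : ∀ {n} (t : Vec (Fin n) (3 + m)) → OrderedBy σ t ⇔ Increasing (permute σ t)
  ordered⇔increasing t = mk⇔
    (λ ordered {i} {j} i<j → ≤-pred (subst₂ _<_ (val-⟨$⟩ˡ i) (val-⟨$⟩ˡ j)
      (ordered (σ ⟨$⟩ˡ i) (σ ⟨$⟩ˡ j) (subst₂ _<_ (sym (rank-⟨$⟩ˡ i)) (sym (rank-⟨$⟩ˡ j)) i<j))))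
    (λ increasing a b a<b →
      s≤s (subst₂ Fin._<_ (lookup-permute σ t a) (lookup-permute σ t b) (increasing a<b)))
    where
    val-⟨$⟩ˡ : ∀ i → val t (σ ⟨$⟩ˡ i) ≡ suc (toℕ (lookup (permute σ t) i))
    val-⟨$⟩ˡ i = cong (suc ∘ toℕ) (sym (lookup∘tabulate (lookup t ∘ (σ ⟨$⟩ˡ_)) i))

  module _ {n} (t : Vec (Fin n) (3 + m)) where

    private
      val-permute : ∀ s → val t s ≡ suc (toℕ (lookup (permute σ t) (σ ⟨$⟩ʳ s)))
      val-permute s = cong (suc ∘ toℕ) (sym (lookup-permute σ t s))

    first-gap⇔ : σ ⟨$⟩ʳ s₁ ≡ zero → (val t s₁ ≡ 1) ⇔ EmptyGap 0 n (permute σ t) zero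
    first-gap⇔ first rewrite val-permute s₁ | first = suc-≡-⇔

    last-gap⇔ : σ ⟨$⟩ʳ s₃ ≡ fromℕ (2 + m) →
      (val t s₃ ≡ n) ⇔ EmptyGap 0 n (permute σ t) (suc (σ ⟨$⟩ʳ s₃))
    last-gap⇔ last rewrite val-permute s₃ | last = ⇔-sym (EmptyGap-last 0 n (permute σ t))

    inner-gap⇔ : ∀ {a b} → rank σ b ≡ suc (rank σ a) →
      (val t b ≡ suc (val t a)) ⇔ EmptyGap 0 n (permute σ t) (suc (σ ⟨$⟩ʳ a))
    inner-gap⇔ {a} {b} adjacent rewrite val-permute a | val-permute b =
      ⇔-sym (EmptyGap-adjacent 0 n (permute σ t) _ _ adjacent) ⇔-∘ suc-≡-⇔

whenTrue-cong : ∀ b {H X Y : Set} → WhenTrue b H → (H → X ⇔ Y) → WhenTrue b X ⇔ WhenTrue b Y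
whenTrue-cong true  h X⇔Y = X⇔Y h
whenTrue-cong false _ _   = ⇔-id _

whenFalse-cong : ∀ b {H X Y : Set} → WhenFalse b H → (H → X ⇔ Y) →
  WhenFalse b X ⇔ WhenTrue (not b) Y
whenFalse-cong true  _ _   = ⇔-id _
whenFalse-cong false h X⇔Y = X⇔Y h

present-not : ∀ b → present (not b) ≡ absent b
present-not true  = refl
present-not false = refl

-- The k_φ conditions of CI_φ; SatCI adds i₁ < i₂ < i₃ to them.
SatCIᵏ : ∀ {n m} → VPattern → Vec (Fin n) (3 + m) → Set
SatCIᵏ {n} φ t =
  WhenTrue  (leftSq φ)  (val t s₁ ≡ 1) ×
  WhenTrue  (rightSq φ) (val t s₃ ≡ n) ×
  WhenFalse (dash12 φ)  (val t s₂ ≡ suc (val t s₁)) ×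
  WhenFalse (dash23 φ)  (val t s₃ ≡ suc (val t s₂))

module _ {m} (φ : VPattern) (σ : TotalOrder m) where

  private
    p₁ p₂ p₃ : Fin (3 + m)
    p₁ = σ ⟨$⟩ʳ s₁
    p₂ = σ ⟨$⟩ʳ s₂
    p₃ = σ ⟨$⟩ʳ s₃

  leftGap rightGap gap₁₂ gap₂₃ forcedGaps : Subset (4 + m)
  leftGap    = when (leftSq φ) ⁅ zero ⁆
  rightGap   = when (rightSq φ) ⁅ suc p₃ ⁆
  gap₁₂      = when (not (dash12 φ)) ⁅ suc p₁ ⁆
  gap₂₃      = when (not (dash23 φ)) ⁅ suc p₂ ⁆
  forcedGaps = leftGap ∪ (rightGap ∪ (gap₁₂ ∪ gap₂₃))

  ∣forcedGaps∣ : Compatible φ σ → ∣ forcedGaps ∣ ≡ kφ φ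
  ∣forcedGaps∣ (p₁<p₂ , p₂<p₃ , _) = begin
    ∣ leftGap ∪ (rightGap ∪ (gap₁₂ ∪ gap₂₃)) ∣
      ≡⟨ ∣when⁅⁆∪q∣ l zero (rightGap ∪ (gap₁₂ ∪ gap₂₃))
           (∉-∪ rightGap (gap₁₂ ∪ gap₂₃) (∉-when⁅⁆ r (suc p₃) λ ())
                (∉-∪ gap₁₂ gap₂₃ (∉-when⁅⁆ (not d₁₂) (suc p₁) λ ())
                                 (∉-when⁅⁆ (not d₂₃) (suc p₂) λ ()))) ⟩
    present l + ∣ rightGap ∪ (gap₁₂ ∪ gap₂₃) ∣
      ≡⟨ cong (present l +_) (∣when⁅⁆∪q∣ r (suc p₃) (gap₁₂ ∪ gap₂₃)
           (∉-∪ gap₁₂ gap₂₃ (∉-when⁅⁆ (not d₁₂) (suc p₁) (≢-sym (suc-≢ (<-trans p₁<p₂ p₂<p₃))))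
                            (∉-when⁅⁆ (not d₂₃) (suc p₂) (≢-sym (suc-≢ p₂<p₃))))) ⟩
    present l + (present r + ∣ gap₁₂ ∪ gap₂₃ ∣)
      ≡⟨ cong (λ x → present l + (present r + x))
              (∣when⁅⁆∪q∣ (not d₁₂) (suc p₁) gap₂₃ (∉-when⁅⁆ (not d₂₃) (suc p₂) (suc-≢ p₁<p₂))) ⟩
    present l + (present r + (present (not d₁₂) + ∣ gap₂₃ ∣))
      ≡⟨ cong₂ (λ x y → present l + (present r + (x + y)))
               (present-not d₁₂) (trans (∣when⁅⁆∣ (not d₂₃) (suc p₂)) (present-not d₂₃)) ⟩
    present l + (present r + (absent d₁₂ + absent d₂₃))
      ≡⟨ rearrange (present l) (present r) (absent d₁₂) (absent d₂₃) ⟩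
    present l + absent d₁₂ + absent d₂₃ + present r
      ∎
    where
    open ≡-Reasoning
    l d₁₂ d₂₃ r : Bool
    l   = leftSq φ
    d₁₂ = dash12 φ
    d₂₃ = dash23 φ
    r   = rightSq φ
    suc-≢ : ∀ {i j : Fin (3 + m)} → i Fin.< j → Fin.suc i ≢ suc j
    suc-≢ i<j = Finₚ.<⇒≢ i<j ∘ Finₚ.suc-injective
    rearrange : ∀ a d b c → a + (d + (b + c)) ≡ a + b + c + d
    rearrange a d b c = begin
      a + (d + (b + c)) ≡⟨ cong (a +_) (+-comm d (b + c)) ⟩
      a + (b + c + d)   ≡⟨ +-assoc a (b + c) d ⟨
      a + (b + c) + d   ≡⟨ cong (_+ d) (+-assoc a b c) ⟨
      a + b + c + d     ∎

  satCIᵏ⇔tight : ∀ {n} (t : Vec (Fin n) (3 + m)) → Compatible φ σ →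
    SatCIᵏ φ t ⇔ Tight forcedGaps (permute σ t)
  satCIᵏ⇔tight {n} t (p₁<p₂ , p₂<p₃ , least , greatest , nothing-between₁₂ , nothing-between₂₃) =
    ⇔-sym tight⇔ ⇔-∘
    (whenTrue-cong  (leftSq φ)  least             (first-gap⇔ σ t ∘ least-rank σ)             ×-⇔
     whenTrue-cong  (rightSq φ) greatest          (last-gap⇔ σ t ∘ greatest-rank σ)           ×-⇔
     whenFalse-cong (dash12 φ)  nothing-between₁₂ (inner-gap⇔ σ t ∘ adjacent-ranks σ p₁<p₂) ×-⇔
     whenFalse-cong (dash23 φ)  nothing-between₂₃ (inner-gap⇔ σ t ∘ adjacent-ranks σ p₂<p₃))
    where
    w : Vec (Fin n) (3 + m)
    w = permute σ t
    gap : Fin (4 + m) → Set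
    gap = EmptyGap 0 n w
    tight⇔ : Tight forcedGaps w ⇔
      (WhenTrue (leftSq φ) (gap zero) × WhenTrue (rightSq φ) (gap (suc p₃)) ×
       WhenTrue (not (dash12 φ)) (gap (suc p₁)) × WhenTrue (not (dash23 φ)) (gap (suc p₂)))
    tight⇔ =
      (Tight-when⁅⁆ w (leftSq φ) zero ×-⇔ Tight-when⁅⁆ w (rightSq φ) (suc p₃) ×-⇔
       Tight-when⁅⁆ w (not (dash12 φ)) (suc p₁) ×-⇔ Tight-when⁅⁆ w (not (dash23 φ)) (suc p₂))
      ⇔-∘ ((⇔-id _ ×-⇔ ⇔-id _ ×-⇔ Tight-∪ w gap₁₂ gap₂₃)
      ⇔-∘ ((⇔-id _ ×-⇔ Tight-∪ w rightGap (gap₁₂ ∪ gap₂₃))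
      ⇔-∘ Tight-∪ w leftGap (rightGap ∪ (gap₁₂ ∪ gap₂₃))))

  good⇔increasing×tight : ∀ {n} (t : Vec (Fin n) (3 + m)) → Compatible φ σ →
    Good φ σ t ⇔ (Increasing (permute σ t) × Tight forcedGaps (permute σ t))
  good⇔increasing×tight t compatible@(p₁<p₂ , p₂<p₃ , _) = mk⇔
    (λ ((_ , _ , satCIᵏ) , ordered) →
      to (ordered⇔increasing σ t) ordered , to (satCIᵏ⇔tight t compatible) satCIᵏ)
    (λ (increasing , tight) → let ordered = from (ordered⇔increasing σ t) increasing in
      (ordered s₁ s₂ p₁<p₂ , ordered s₂ s₃ p₂<p₃ , from (satCIᵏ⇔tight t compatible) tight) , ordered)

  v≡countTight : ∀ n → Compatible φ σ → v n φ σ ≡ countTight n (3 + m) forcedGaps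
  v≡countTight n compatible =
    length-filter-bijection (good? φ σ) (tight? forcedGaps)
      (allTuples-unique n (3 + m)) (allIncreasing-unique n (3 + m)) (permute σ) (permute-injective σ) into onto
    where
    into : ∀ {t} → t ∈ allTuples n (3 + m) → Good φ σ t →
      permute σ t ∈ allIncreasing n (3 + m) × Tight forcedGaps (permute σ t)
    into {t} _ good with increasing , tight ← to (good⇔increasing×tight t compatible) good =
      ∈-allIncreasing⁺ increasing , tight
    onto : ∀ {w} → w ∈ allIncreasing n (3 + m) → Tight forcedGaps w →
      ∃[ t ] t ∈ allTuples n (3 + m) × Good φ σ t × permute σ t ≡ w
    onto {w} w∈ tight =
      t , ∈-allTuples t , from (good⇔increasing×tight t compatible) increasing&tight , permute-flip-inverse σ w
      where
      t : Vec (Fin n) (3 + m)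
      t = permute (flip σ) w
      increasing&tight : Increasing (permute σ t) × Tight forcedGaps (permute σ t)
      increasing&tight = subst (λ u → Increasing u × Tight forcedGaps u) (sym (permute-flip-inverse σ w))
                               (∈-allIncreasing⁻ w∈ , tight)

lemma4p2 : (n : ℕ) → 3 ≤ n → (φ : VPattern) → kφ φ ≤ 3 →
           (m : ℕ) → (σ : TotalOrder m) → Compatible φ σ →
           v n φ σ ≡ (n ∸ kφ φ) C ((3 + m) ∸ kφ φ)
lemma4p2 n 3≤n φ kφ≤3 m σ compatible = begin
  v n φ σ
    ≡⟨ v≡countTight φ σ n compatible ⟩
  countTight n (3 + m) (forcedGaps φ σ)
    ≡⟨ countTight-binomial (forcedGaps φ σ) k≤ℓ k≤n ⟩
  (n ∸ k) C ((3 + m) ∸ k)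
    ≡⟨ cong (λ k → (n ∸ k) C ((3 + m) ∸ k)) (∣forcedGaps∣ φ σ compatible) ⟩
  (n ∸ kφ φ) C ((3 + m) ∸ kφ φ)
    ∎
  where
  open ≡-Reasoning
  k : ℕ
  k = ∣ forcedGaps φ σ ∣
  k≤3 : k ≤ 3
  k≤3 = subst (_≤ 3) (sym (∣forcedGaps∣ φ σ compatible)) kφ≤3
  k≤ℓ : k ≤ 3 + m
  k≤ℓ = ≤-trans k≤3 (m≤m+n 3 m)
  k≤n : k ≤ n
  k≤n = ≤-trans k≤3 3≤n
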